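{- Let $N$ be a positive integer, $[N]=\{1,\ldots,N\}$, and $t=1+\sum_{i=0}^{\lfloor\log_3 N\rfloor}3^i=\frac{3^{\lfloor\log_3 N\rfloor+1}+1}{2}$. Let $\{\log_3 N\}=\log_3 N-\lfloor\log_3 N\rfloor$. The following are equivalent: (i) $\{\log_3 N\}>1-\log_3 2$; (ii) the set $S_2=\{1,3,3^2,\ldots,3^{\lfloor\log_3 N\rfloor}\}\cup\{t\}$ is a subset of $[N]$ which is a minimum 1-spanning subset of $[N]$ (i.e. $\langle S_2\rangle\supset[N]$ and $|S_2|=d_s([N])$) and is a maximal dissociated subset of $[N]$. In particular, when these hold, $d_s([N])=d_d^-([N])=\lfloor\log_3 N\rfloor+2$.
   Context: $[N]$ is viewed as an additive set in $\mathbb{Z}$. The 1-span $\langle S\rangle$ is the set of all sums $\sum_{s\in S}\varepsilon_s s$ with $\varepsilon_s\in\{ -1,0,1\}$; $d_s(A)=\min\{|S|:S\subset A,\ \langle S\rangle\supset A\}$. A set is dissociated if its subset sums are pairwise distinct; $D\subset A$ is maximal dissociated in $A$ if no dissociated $D'\subset A$ strictly contains $D$; $d_d^-(A)=\min\{|D|:D\subset A\text{ maximal dissociated}\}$. -}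

module Defs where

open import Data.Nat using (ℕ; zero; suc; _+_; _*_; _^_; _≤_; _<_)
open import Data.Integer as ℤ using (ℤ; +_)
open import Data.List using (List; []; _∷_; _++_; map; upTo; length; concatMap)
open import Data.Nat.ListAction using (sum)
open import Data.Empty using (⊥)
open import Data.List.Relation.Unary.All using (All)
open import Data.List.Relation.Unary.Unique.Propositional using (Unique)
open import Data.List.Membership.Propositional using (_∈_; _∉_)
open import Data.Vec using (Vec; []; _∷_)
open import Data.Bool using (Bool; true; false)
open import Data.Product using (_×_; ∃; ∃-syntax)
open import Relation.Binary.PropositionalEquality using (_≡_)

-- A finite subset of [N] = {1,…,N}: a duplicate-free list of elements of [N].
-- Its cardinality is its length.
IsSubsetOf[_] : ℕ → List ℕ → Set
IsSubsetOf[ N ] S = Unique S × All (λ x → 1 ≤ x × x ≤ N) S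

signedSums : List ℕ → List ℤ
signedSums []      = + 0 ∷ []
signedSums (s ∷ S) =
  concatMap (λ z → (z ℤ.- + s) ∷ z ∷ (z ℤ.+ + s) ∷ []) (signedSums S)

_∈Span_ : ℕ → List ℕ → Set
x ∈Span S = (+ x) ∈ signedSums S

Spans[_] : ℕ → List ℕ → Set
Spans[ N ] S = ∀ x → 1 ≤ x → x ≤ N → x ∈Span S

subsetSum : (S : List ℕ) → Vec Bool (length S) → ℕ
subsetSum []      []          = 0
subsetSum (s ∷ S) (true  ∷ b) = s + subsetSum S b
subsetSum (s ∷ S) (false ∷ b) = subsetSum S b

Dissociated : List ℕ → Set
Dissociated S = ∀ b b′ → subsetSum S b ≡ subsetSum S b′ → b ≡ b′

MaximalDissociatedIn[_] : ℕ → List ℕ → Set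
MaximalDissociatedIn[ N ] D =
  IsSubsetOf[ N ] D × Dissociated D ×
  (∀ D′ → IsSubsetOf[ N ] D′ → Dissociated D′ →
     (∀ {x} → x ∈ D → x ∈ D′) → ∃[ y ] (y ∈ D′ × y ∉ D) → ⊥)

MinSpanning[_] : ℕ → List ℕ → Set
MinSpanning[ N ] S =
  IsSubsetOf[ N ] S × Spans[ N ] S ×
  (∀ S′ → IsSubsetOf[ N ] S′ → Spans[ N ] S′ → length S ≤ length S′)

DsIs : ℕ → ℕ → Set
DsIs N d = ∃[ S ] (MinSpanning[ N ] S × length S ≡ d)

DdMinusIs : ℕ → ℕ → Set
DdMinusIs N d =
  ∃[ D ] (MaximalDissociatedIn[ N ] D × length D ≡ d) ×
  (∀ D → MaximalDissociatedIn[ N ] D → d ≤ length D)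

tOf : ℕ → ℕ
tOf k = suc (sum (map (3 ^_) (upTo (suc k))))

S₂ : ℕ → List ℕ
S₂ k = map (3 ^_) (upTo (suc k)) ++ (tOf k ∷ [])

-- Balanced ternary: the powers 1, 3, …, 3^k are dissociated and their signed sums are
-- exactly the integers of absolute value at most σ = (3^(k+1) − 1)/2.  Adding t = σ + 1,
-- which exceeds the sum of all the powers, keeps the set dissociated and extends the
-- signed sums to [0, 3^(k+1)] ⊇ [N].  So S₂ ⊆ [N] iff t ≤ N iff 3^(k+1) < 2N, and then S₂
-- is spanning and dissociated, hence maximal dissociated.  Conversely any set L whose
-- signed sums cover [−N, N] has 2N + 1 ≤ 3^|L|, which for 3^(k+1) < 2N forces |L| ≥ k + 2;
-- as a maximal dissociated set spans, this bounds both d_s and d_d^- from below.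
module Submission where

open import Defs
open import Data.Bool using (Bool; true; false)
open import Data.Empty using (⊥; ⊥-elim)
open import Data.Integer as ℤ using (ℤ; +_; -[1+_]) renaming (_+_ to _+ᶻ_; _-_ to _-ᶻ_; -_ to -ᶻ_)
import Data.Integer.Properties as ℤₚ
open import Data.Integer.Tactic.RingSolver using (solve-∀)
open import Data.List using (List; []; _∷_; _++_; map; upTo; length; concatMap)
import Data.List.Properties as Listₚ
open import Data.List.Membership.Propositional using (_∈_; _∉_; find)
open import Data.List.Membership.Propositional.Properties using (∈-concatMap⁺; ∈-concatMap⁻; ∈-∃++; ∈-++⁻; ∈-++⁺ˡ; ∈-++⁺ʳ; ∈-upTo⁻)
open import Data.List.Membership.DecPropositional ℤₚ._≟_ using (_∈?_)
open import Data.List.Relation.Binary.Subset.Propositional using (_⊆_)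
open import Data.List.Relation.Unary.All as All using (All; []; _∷_)
import Data.List.Relation.Unary.All.Properties as Allₚ
open import Data.List.Relation.Unary.Any as Any using (here; there)
open import Data.List.Relation.Unary.AllPairs using ([]; _∷_)
open import Data.List.Relation.Unary.Unique.Propositional using (Unique)
import Data.List.Relation.Unary.Unique.Propositional.Properties as Uniqueₚ
open import Data.Nat using (ℕ; zero; suc; _+_; _*_; _^_; _∸_; _≤_; _<_; z≤n; s≤s; _≤?_; NonZero)
import Data.Nat.Properties as ℕₚ
open import Data.Nat.ListAction using (sum)
open import Data.Nat.ListAction.Properties using (sum-++)
open import Data.Nat.Tactic.RingSolver using () renaming (solve-∀ to solve-∀ℕ)
open import Data.Product as Product using (_×_; _,_; proj₂; ∃₂; ∃-syntax)
open import Data.Sum using (inj₁; inj₂)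
open import Data.Vec using (Vec; []; _∷_)
import Data.Vec.Properties as Vecₚ
open import Function.Base using (_∘_)
open import Function.Bundles using (_⇔_; mk⇔; Equivalence)
open import Relation.Binary.PropositionalEquality
open import Relation.Nullary using (yes; no)

private
  variable
    A : Set
    N : ℕ
    L S D : List ℕ

⊆-delete : ∀ {x : A} {xs} us vs → xs ⊆ us ++ x ∷ vs → x ∉ xs → xs ⊆ us ++ vs
⊆-delete us vs sub x∉xs z∈xs with ∈-++⁻ us (sub z∈xs)
... | inj₁ z∈us         = ∈-++⁺ˡ z∈us
... | inj₂ (here refl)  = ⊥-elim (x∉xs z∈xs)
... | inj₂ (there z∈vs) = ∈-++⁺ʳ us z∈vs

∷⊆-split : ∀ {x : A} {xs ys} → Unique (x ∷ xs) → x ∷ xs ⊆ ys →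
  ∃₂ λ us vs → ys ≡ us ++ x ∷ vs × xs ⊆ us ++ vs
∷⊆-split (x∉xs ∷ _) sub with us , vs , refl ← ∈-∃++ (sub (here refl)) =
  us , vs , refl , ⊆-delete us vs (sub ∘ there) (λ x∈xs → All.lookup x∉xs x∈xs refl)

unique-⊆⇒length-≤ : ∀ {xs ys : List A} → Unique xs → xs ⊆ ys → length xs ≤ length ys
unique-⊆⇒length-≤ {xs = []}    _ _ = z≤n
unique-⊆⇒length-≤ {xs = x ∷ _} u@(_ ∷ u′) sub with us , vs , refl , sub′ ← ∷⊆-split u sub =
  ℕₚ.≤-trans (s≤s (unique-⊆⇒length-≤ u′ sub′)) (ℕₚ.≤-reflexive (sym (Listₚ.length-++-sucʳ us x vs)))

unique-∷ʳ : ∀ {xs y} → Unique xs → All (_< y) xs → Unique (xs ++ y ∷ [])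
unique-∷ʳ u xs<y = Uniqueₚ.++⁺ u ([] ∷ []) λ { (v∈xs , here refl) → ℕₚ.<-irrefl refl (All.lookup xs<y v∈xs) }

∈⇒≤sum : ∀ {x xs} → x ∈ xs → x ≤ sum xs
∈⇒≤sum {xs = y ∷ xs} (here refl) = ℕₚ.m≤m+n y (sum xs)
∈⇒≤sum {xs = y ∷ xs} (there x∈) = ℕₚ.≤-trans (∈⇒≤sum x∈) (ℕₚ.m≤n+m (sum xs) y)

data Sign : Set where
  minus none plus : Sign

_·_ : Sign → ℕ → ℤ
minus · s = -ᶻ + s
none  · s = + 0
plus  · s = + s

opposite : Sign → Sign
opposite minus = plus
opposite none  = none
opposite plus  = minus

neg-· : ∀ ε s → -ᶻ (ε · s) ≡ opposite ε · s
neg-· minus s = ℤₚ.neg-involutive (+ s)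
neg-· none  s = refl
neg-· plus  s = refl

private
  shifts : ℕ → ℤ → List ℤ
  shifts s z = (z -ᶻ + s) ∷ z ∷ (z +ᶻ + s) ∷ []

  +-right-comm : ∀ (a b c : ℤ) → (a +ᶻ b) +ᶻ c ≡ (a +ᶻ c) +ᶻ b
  +-right-comm = solve-∀

  i+j-j≡i : ∀ (i j : ℤ) → (i +ᶻ j) -ᶻ j ≡ i
  i+j-j≡i = solve-∀

  i-j+j≡i : ∀ (i j : ℤ) → (i -ᶻ j) +ᶻ j ≡ i
  i-j+j≡i = solve-∀

signedSums-∷⁺ : ∀ {z} s L ε → z ∈ signedSums L → z +ᶻ ε · s ∈ signedSums (s ∷ L)
signedSums-∷⁺ {z} s L ε z∈ = ∈-concatMap⁺ (shifts s) (Any.map (λ { refl → ∈shifts ε }) z∈)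
  where
  ∈shifts : ∀ ε → z +ᶻ ε · s ∈ shifts s z
  ∈shifts minus = here refl
  ∈shifts none  = there (here (ℤₚ.+-identityʳ z))
  ∈shifts plus  = there (there (here refl))

signedSums-∷⁻ : ∀ {w} s L → w ∈ signedSums (s ∷ L) →
  ∃₂ λ z ε → z ∈ signedSums L × w ≡ z +ᶻ ε · s
signedSums-∷⁻ s L w∈ with find (∈-concatMap⁻ (shifts s) {xs = signedSums L} w∈)
... | z , z∈ , here eq                = z , minus , z∈ , eq
... | z , z∈ , there (here eq)        = z , none  , z∈ , trans eq (sym (ℤₚ.+-identityʳ z))
... | z , z∈ , there (there (here eq)) = z , plus , z∈ , eq

0∈signedSums : ∀ L → + 0 ∈ signedSums L
0∈signedSums []      = here refl
0∈signedSums (s ∷ L) = signedSums-∷⁺ s L none (0∈signedSums L)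

∈⇒∈signedSums : ∀ {x} L → x ∈ L → + x ∈ signedSums L
∈⇒∈signedSums (s ∷ L) (here refl) =
  subst (_∈ signedSums (s ∷ L)) (ℤₚ.+-identityˡ (+ s)) (signedSums-∷⁺ s L plus (0∈signedSums L))
∈⇒∈signedSums (s ∷ L) (there x∈) =
  subst (_∈ signedSums (s ∷ L)) (ℤₚ.+-identityʳ _) (signedSums-∷⁺ s L none (∈⇒∈signedSums L x∈))

signedSums-neg : ∀ {w} L → w ∈ signedSums L → -ᶻ w ∈ signedSums L
signedSums-neg []      (here refl) = here refl
signedSums-neg (s ∷ L) w∈ with z , ε , z∈ , refl ← signedSums-∷⁻ s L w∈ =
  subst (_∈ signedSums (s ∷ L)) -[z+ε·s] (signedSums-∷⁺ s L (opposite ε) (signedSums-neg L z∈))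
  where
  -[z+ε·s] : -ᶻ z +ᶻ opposite ε · s ≡ -ᶻ (z +ᶻ ε · s)
  -[z+ε·s] = trans (cong (-ᶻ z +ᶻ_) (sym (neg-· ε s))) (sym (ℤₚ.neg-distrib-+ z (ε · s)))

signedSums-insert : ∀ {w} us vs s ε → w ∈ signedSums (us ++ vs) → w +ᶻ ε · s ∈ signedSums (us ++ s ∷ vs)
signedSums-insert []       vs s ε w∈ = signedSums-∷⁺ s vs ε w∈
signedSums-insert (u ∷ us) vs s ε w∈ with z , ε′ , z∈ , refl ← signedSums-∷⁻ u (us ++ vs) w∈ =
  subst (_∈ signedSums (u ∷ us ++ s ∷ vs)) (+-right-comm z (ε · s) (ε′ · u))
    (signedSums-∷⁺ u (us ++ s ∷ vs) ε′ (signedSums-insert us vs s ε z∈))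

signedSums-∷ʳ : ∀ {w} L s ε → w ∈ signedSums L → w +ᶻ ε · s ∈ signedSums (L ++ s ∷ [])
signedSums-∷ʳ L s ε w∈ = signedSums-insert L [] s ε (subst (λ l → _ ∈ signedSums l) (sym (Listₚ.++-identityʳ L)) w∈)

signedSums-mono : Unique S → S ⊆ L → signedSums S ⊆ signedSums L
signedSums-mono {[]}    {L} _ _ (here refl) = 0∈signedSums L
signedSums-mono {s ∷ S} u@(_ ∷ u′) sub w∈
  with z , ε , z∈ , refl ← signedSums-∷⁻ s S w∈
     | us , vs , refl , sub′ ← ∷⊆-split u sub =
  signedSums-insert us vs s ε (signedSums-mono u′ sub′ z∈)

length-signedSums : ∀ L → length (signedSums L) ≡ 3 ^ length L
length-signedSums []      = refl
length-signedSums (s ∷ L) = trans (length-concatMap-shifts (signedSums L)) (cong (3 *_) (length-signedSums L))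
  where
  length-concatMap-shifts : ∀ zs → length (concatMap (shifts s) zs) ≡ 3 * length zs
  length-concatMap-shifts []       = refl
  length-concatMap-shifts (_ ∷ zs) = trans (cong (_+_ 3) (length-concatMap-shifts zs)) (sym (ℕₚ.*-suc 3 (length zs)))

SpansUpTo : ℕ → List ℕ → Set
SpansUpTo m L = ∀ x → x ≤ m → x ∈Span L

-- A new element p ≤ 2m + 1 reaches m < x ≤ m + p either as p − (p ∸ x) or as (x ∸ p) + p.
spansUpTo-∷ʳ : ∀ {m p} L → p ≤ suc (m + m) → SpansUpTo m L → SpansUpTo (m + p) (L ++ p ∷ [])
spansUpTo-∷ʳ {m} {p} L p≤ span x x≤ with x ≤? m | x ≤? p
... | yes x≤m | _ =
  subst (_∈ signedSums (L ++ p ∷ [])) (ℤₚ.+-identityʳ (+ x)) (signedSums-∷ʳ L p none (span x x≤m))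
... | no x≰m | yes x≤p =
  subst (_∈ signedSums (L ++ p ∷ [])) p-[p∸x]≡x (signedSums-∷ʳ L p plus (signedSums-neg L (span (p ∸ x) p∸x≤m)))
  where
  p∸x≤m : p ∸ x ≤ m
  p∸x≤m = ℕₚ.≤-trans (ℕₚ.∸-mono p≤ (ℕₚ.≰⇒> x≰m)) (ℕₚ.≤-reflexive (ℕₚ.m+n∸m≡n m m))
  p-[p∸x]≡x : -ᶻ + (p ∸ x) +ᶻ + p ≡ + x
  p-[p∸x]≡x = trans (ℤₚ.-m+n≡n⊖m (p ∸ x) p)
    (trans (ℤₚ.⊖-≥ (ℕₚ.m∸n≤m p x)) (cong +_ (ℕₚ.m∸[m∸n]≡n x≤p)))
... | no _ | no x≰p =
  subst (_∈ signedSums (L ++ p ∷ [])) (cong +_ (ℕₚ.m∸n+n≡m (ℕₚ.<⇒≤ (ℕₚ.≰⇒> x≰p))))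
    (signedSums-∷ʳ L p plus (span (x ∸ p) x∸p≤m))
  where
  x∸p≤m : x ∸ p ≤ m
  x∸p≤m = ℕₚ.≤-trans (ℕₚ.∸-monoˡ-≤ p x≤) (ℕₚ.≤-reflexive (ℕₚ.m+n∸n≡m m p))

symmetricInterval : ℕ → List ℤ
symmetricInterval zero    = + 0 ∷ []
symmetricInterval (suc n) = + suc n ∷ -[1+ n ] ∷ symmetricInterval n

symmetricInterval-bounded : ∀ n → All (λ z → ℤ.∣ z ∣ ≤ n) (symmetricInterval n)
symmetricInterval-bounded zero    = z≤n ∷ []
symmetricInterval-bounded (suc n) =
  ℕₚ.≤-refl ∷ ℕₚ.≤-refl ∷ All.map ℕₚ.m≤n⇒m≤1+n (symmetricInterval-bounded n)

symmetricInterval-unique : ∀ n → Unique (symmetricInterval n)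
symmetricInterval-unique zero    = [] ∷ []
symmetricInterval-unique (suc n) =
  ((λ ()) ∷ All.map (larger refl) (symmetricInterval-bounded n)) ∷
  All.map (larger refl) (symmetricInterval-bounded n) ∷ symmetricInterval-unique n
  where
  larger : ∀ {w z} → ℤ.∣ w ∣ ≡ suc n → ℤ.∣ z ∣ ≤ n → w ≢ z
  larger ∣w∣≡ ∣z∣≤ refl = ℕₚ.1+n≰n (subst (_≤ n) ∣w∣≡ ∣z∣≤)

length-symmetricInterval : ∀ n → length (symmetricInterval n) ≡ suc (n + n)
length-symmetricInterval zero    = refl
length-symmetricInterval (suc n) =
  cong (suc ∘ suc) (trans (length-symmetricInterval n) (sym (ℕₚ.+-suc n n)))

spans⇒symmetricInterval⊆ : ∀ n → Spans[ n ] L → symmetricInterval n ⊆ signedSums L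
spans⇒symmetricInterval⊆ {L} zero    _    (here refl)         = 0∈signedSums L
spans⇒symmetricInterval⊆     (suc n) span (here refl)         = span (suc n) (s≤s z≤n) ℕₚ.≤-refl
spans⇒symmetricInterval⊆ {L} (suc n) span (there (here refl)) = signedSums-neg L (span (suc n) (s≤s z≤n) ℕₚ.≤-refl)
spans⇒symmetricInterval⊆ {L} (suc n) span (there (there z∈))  =
  spans⇒symmetricInterval⊆ {L} n (λ x 1≤x x≤n → span x 1≤x (ℕₚ.m≤n⇒m≤1+n x≤n)) z∈

spans⇒length : ∀ L → Spans[ N ] L → suc (N + N) ≤ 3 ^ length L
spans⇒length {N} L span = begin
  suc (N + N)                      ≡⟨ length-symmetricInterval N ⟨
  length (symmetricInterval N)     ≤⟨ unique-⊆⇒length-≤ (symmetricInterval-unique N) (spans⇒symmetricInterval⊆ {L} N span) ⟩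
  length (signedSums L)            ≡⟨ length-signedSums L ⟩
  3 ^ length L                     ∎
  where open ℕₚ.≤-Reasoning

bit : Bool → ℕ → ℕ
bit true  s = s
bit false s = 0

sign : Bool → Bool → Sign
sign true  false = plus
sign false true  = minus
sign _     _     = none

subsetSum-∷ : ∀ s L c b → subsetSum (s ∷ L) (c ∷ b) ≡ bit c s + subsetSum L b
subsetSum-∷ s L true  b = refl
subsetSum-∷ s L false b = refl

bit-difference : ∀ c c′ s → + bit c s -ᶻ + bit c′ s ≡ sign c c′ · s
bit-difference true  true  s = ℤₚ.+-inverseʳ (+ s)
bit-difference true  false s = ℤₚ.+-identityʳ (+ s)
bit-difference false true  s = ℤₚ.+-identityˡ (-ᶻ + s)
bit-difference false false s = refl

subsetSum-difference-∷ : ∀ s L c c′ b b′ →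
  + subsetSum (s ∷ L) (c ∷ b) -ᶻ + subsetSum (s ∷ L) (c′ ∷ b′) ≡
  (+ subsetSum L b -ᶻ + subsetSum L b′) +ᶻ sign c c′ · s
subsetSum-difference-∷ s L c c′ b b′ = begin
  + subsetSum (s ∷ L) (c ∷ b) -ᶻ + subsetSum (s ∷ L) (c′ ∷ b′)
    ≡⟨ cong₂ (λ x y → + x -ᶻ + y) (subsetSum-∷ s L c b) (subsetSum-∷ s L c′ b′) ⟩
  (+ bit c s +ᶻ + subsetSum L b) -ᶻ (+ bit c′ s +ᶻ + subsetSum L b′)
    ≡⟨ regroup (+ bit c s) (+ bit c′ s) (+ subsetSum L b) (+ subsetSum L b′) ⟩
  (+ subsetSum L b -ᶻ + subsetSum L b′) +ᶻ (+ bit c s -ᶻ + bit c′ s)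
    ≡⟨ cong ((+ subsetSum L b -ᶻ + subsetSum L b′) +ᶻ_) (bit-difference c c′ s) ⟩
  (+ subsetSum L b -ᶻ + subsetSum L b′) +ᶻ sign c c′ · s ∎
  where
  open ≡-Reasoning
  regroup : ∀ x y a a′ → (x +ᶻ a) -ᶻ (y +ᶻ a′) ≡ (a -ᶻ a′) +ᶻ (x -ᶻ y)
  regroup = solve-∀

subsetSum-difference∈signedSums : ∀ L b b′ → + subsetSum L b -ᶻ + subsetSum L b′ ∈ signedSums L
subsetSum-difference∈signedSums []      []      []        = here refl
subsetSum-difference∈signedSums (s ∷ L) (c ∷ b) (c′ ∷ b′) =
  subst (_∈ signedSums (s ∷ L)) (sym (subsetSum-difference-∷ s L c c′ b b′))
    (signedSums-∷⁺ s L (sign c c′) (subsetSum-difference∈signedSums L b b′))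

signedSums⇒subsetSum-difference : ∀ {w} L → w ∈ signedSums L →
  ∃₂ λ b b′ → w ≡ + subsetSum L b -ᶻ + subsetSum L b′
signedSums⇒subsetSum-difference []      (here refl) = [] , [] , refl
signedSums⇒subsetSum-difference (s ∷ L) w∈
  with z , ε , z∈ , refl ← signedSums-∷⁻ s L w∈
  with b , b′ , refl ← signedSums⇒subsetSum-difference L z∈
  with ε
... | minus = false ∷ b , true  ∷ b′ , sym (subsetSum-difference-∷ s L false true  b b′)
... | none  = false ∷ b , false ∷ b′ , sym (subsetSum-difference-∷ s L false false b b′)
... | plus  = true  ∷ b , false ∷ b′ , sym (subsetSum-difference-∷ s L true  false b b′)

subsetSum-gap∈signedSums : ∀ {x} L b b′ → x + subsetSum L b ≡ subsetSum L b′ → + x ∈ signedSums L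
subsetSum-gap∈signedSums {x} L b b′ eq =
  subst (_∈ signedSums L) x≡ (subsetSum-difference∈signedSums L b′ b)
  where
  x≡ : + subsetSum L b′ -ᶻ + subsetSum L b ≡ + x
  x≡ = trans (cong (λ y → + y -ᶻ + subsetSum L b) (sym eq)) (i+j-j≡i (+ x) (+ subsetSum L b))

signedSums⇒subsetSum-gap : ∀ {x} L → + x ∈ signedSums L → ∃₂ λ b b′ → x + subsetSum L b′ ≡ subsetSum L b
signedSums⇒subsetSum-gap {x} L x∈ with b , b′ , eq ← signedSums⇒subsetSum-difference L x∈ =
  b , b′ , ℤₚ.+-injective (trans (cong (_+ᶻ + subsetSum L b′) eq) (i-j+j≡i (+ subsetSum L b) (+ subsetSum L b′)))

subsetSum≤sum : ∀ L b → subsetSum L b ≤ sum L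
subsetSum≤sum []      []          = z≤n
subsetSum≤sum (s ∷ L) (true  ∷ b) = ℕₚ.+-monoʳ-≤ s (subsetSum≤sum L b)
subsetSum≤sum (s ∷ L) (false ∷ b) = ℕₚ.≤-trans (subsetSum≤sum L b) (ℕₚ.m≤n+m (sum L) s)

insertBit : ∀ us {s : ℕ} {vs} → Bool → Vec Bool (length (us ++ vs)) → Vec Bool (length (us ++ s ∷ vs))
insertBit []       c v       = c ∷ v
insertBit (_ ∷ us) c (x ∷ v) = x ∷ insertBit us c v

insertBit-surjective : ∀ us {s : ℕ} {vs} (w : Vec Bool (length (us ++ s ∷ vs))) →
  ∃₂ λ c v → w ≡ insertBit us c v
insertBit-surjective []       (c ∷ v) = c , v , refl
insertBit-surjective (_ ∷ us) (x ∷ w) with c , v , refl ← insertBit-surjective us w = c , x ∷ v , refl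

insertBit-true≢false : ∀ us {s : ℕ} {vs} v v′ → insertBit us {s} {vs} true v ≢ insertBit us false v′
insertBit-true≢false []       v       v′        ()
insertBit-true≢false (_ ∷ us) (_ ∷ v) (_ ∷ v′) eq = insertBit-true≢false us v v′ (Vecₚ.∷-injectiveʳ eq)

subsetSum-insert : ∀ us {s vs} c v →
  subsetSum (us ++ s ∷ vs) (insertBit us c v) ≡ bit c s + subsetSum (us ++ vs) v
subsetSum-insert []            {s} {vs} c v           = subsetSum-∷ s vs c v
subsetSum-insert (u ∷ us) {s}      c (true  ∷ v) =
  trans (cong (_+_ u) (subsetSum-insert us c v)) (+-left-comm u (bit c s) _)
  where
  +-left-comm : ∀ a b c → a + (b + c) ≡ b + (a + c)
  +-left-comm = solve-∀ℕ
subsetSum-insert (u ∷ us)          c (false ∷ v) = subsetSum-insert us c v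

sum<⇒+subsetSum≢subsetSum : ∀ {s} L → sum L < s → ∀ b b′ → s + subsetSum L b ≢ subsetSum L b′
sum<⇒+subsetSum≢subsetSum {s} L sum<s b b′ eq = ℕₚ.<-irrefl refl (begin-strict
  s                  ≤⟨ ℕₚ.m≤m+n s _ ⟩
  s + subsetSum L b  ≡⟨ eq ⟩
  subsetSum L b′     ≤⟨ subsetSum≤sum L b′ ⟩
  sum L              <⟨ sum<s ⟩
  s                  ∎)
  where open ℕₚ.≤-Reasoning

dissociated-insert : ∀ us vs s → Dissociated (us ++ vs) → sum (us ++ vs) < s → Dissociated (us ++ s ∷ vs)
dissociated-insert us vs s d sum<s w w′ eq
  with c , v , refl ← insertBit-surjective us w | c′ , v′ , refl ← insertBit-surjective us w′
  with eq′ ← trans (sym (subsetSum-insert us c v)) (trans eq (subsetSum-insert us c′ v′))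
  with c | c′
... | true  | true  = cong (insertBit us true) (d v v′ (ℕₚ.+-cancelˡ-≡ s _ _ eq′))
... | false | false = cong (insertBit us false) (d v v′ eq′)
... | true  | false = ⊥-elim (sum<⇒+subsetSum≢subsetSum (us ++ vs) sum<s v v′ eq′)
... | false | true  = ⊥-elim (sum<⇒+subsetSum≢subsetSum (us ++ vs) sum<s v′ v (sym eq′))

dissociated-∷ʳ : ∀ L s → Dissociated L → sum L < s → Dissociated (L ++ s ∷ [])
dissociated-∷ʳ L s d sum<s =
  dissociated-insert L [] s (subst Dissociated L≡ d) (subst (λ l → sum l < s) L≡ sum<s)
  where
  L≡ : L ≡ L ++ []
  L≡ = sym (Listₚ.++-identityʳ L)

dissociated-∷ : ∀ {x} D → Dissociated D → + x ∉ signedSums D → Dissociated (x ∷ D)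
dissociated-∷ {x} D d x∉ (true  ∷ b) (true  ∷ b′) eq = cong (true ∷_) (d b b′ (ℕₚ.+-cancelˡ-≡ x _ _ eq))
dissociated-∷     D d x∉ (false ∷ b) (false ∷ b′) eq = cong (false ∷_) (d b b′ eq)
dissociated-∷     D d x∉ (true  ∷ b) (false ∷ b′) eq = ⊥-elim (x∉ (subsetSum-gap∈signedSums D b b′ eq))
dissociated-∷     D d x∉ (false ∷ b) (true  ∷ b′) eq = ⊥-elim (x∉ (subsetSum-gap∈signedSums D b′ b (sym eq)))

dissociated⇒∉signedSums : ∀ us {y} vs → Dissociated (us ++ y ∷ vs) → + y ∉ signedSums (us ++ vs)
dissociated⇒∉signedSums us vs d y∈ with b , b′ , eq ← signedSums⇒subsetSum-gap (us ++ vs) y∈ =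
  insertBit-true≢false us b′ b (d (insertBit us true b′) (insertBit us false b)
    (trans (subsetSum-insert us true b′) (trans eq (sym (subsetSum-insert us false b)))))

maximalDissociated⇒spans : MaximalDissociatedIn[ N ] D → Spans[ N ] D
maximalDissociated⇒spans {D = D} ((u , bounds) , d , maximal) x 1≤x x≤N with + x ∈? signedSums D
... | yes x∈ = x∈
... | no  x∉ = ⊥-elim (maximal (x ∷ D) (Allₚ.¬Any⇒All¬ D x∉D ∷ u , (1≤x , x≤N) ∷ bounds)
                          (dissociated-∷ D d x∉) there (x , here refl , x∉D))
  where
  x∉D : x ∉ D
  x∉D = x∉ ∘ ∈⇒∈signedSums D

-- Any element y of a dissociated D′ ⊇ S outside S lies in ⟨S⟩ ⊆ ⟨D′ ∖ {y}⟩.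
dissociated∧spans⇒maximal : IsSubsetOf[ N ] S → Dissociated S → Spans[ N ] S → MaximalDissociatedIn[ N ] S
dissociated∧spans⇒maximal {N} {S} S⊆[N]@(u , _) d span = S⊆[N] , d , no-extension
  where
  no-extension : ∀ D′ → IsSubsetOf[ N ] D′ → Dissociated D′ → S ⊆ D′ → ∃[ y ] (y ∈ D′ × y ∉ S) → ⊥
  no-extension D′ (_ , bounds′) d′ S⊆D′ (y , y∈D′ , y∉S)
    with us , vs , refl ← ∈-∃++ y∈D′ with 1≤y , y≤N ← All.lookup bounds′ y∈D′ =
    dissociated⇒∉signedSums us vs d′
      (signedSums-mono u (⊆-delete us vs S⊆D′ y∉S) (span y 1≤y y≤N))

powersOf3 : ℕ → List ℕ
powersOf3 n = map (3 ^_) (upTo n)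

powersOf3-suc : ∀ n → powersOf3 (suc n) ≡ powersOf3 n ++ 3 ^ n ∷ []
powersOf3-suc n =
  trans (cong (map (3 ^_)) (sym (Listₚ.upTo-∷ʳ n))) (Listₚ.map-++ (3 ^_) (upTo n) (n ∷ []))

sum-powersOf3-suc : ∀ n → sum (powersOf3 (suc n)) ≡ sum (powersOf3 n) + 3 ^ n
sum-powersOf3-suc n = begin
  sum (powersOf3 (suc n))                 ≡⟨ cong sum (powersOf3-suc n) ⟩
  sum (powersOf3 n ++ 3 ^ n ∷ [])         ≡⟨ sum-++ (powersOf3 n) (3 ^ n ∷ []) ⟩
  sum (powersOf3 n) + (3 ^ n + 0)         ≡⟨ cong (_+_ (sum (powersOf3 n))) (ℕₚ.+-identityʳ (3 ^ n)) ⟩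
  sum (powersOf3 n) + 3 ^ n               ∎
  where open ≡-Reasoning

1+2*sum-powersOf3 : ∀ n → suc (sum (powersOf3 n) + sum (powersOf3 n)) ≡ 3 ^ n
1+2*sum-powersOf3 zero    = refl
1+2*sum-powersOf3 (suc n) = begin
  suc (sum (powersOf3 (suc n)) + sum (powersOf3 (suc n)))  ≡⟨ cong (λ m → suc (m + m)) (sum-powersOf3-suc n) ⟩
  suc ((σ + 3 ^ n) + (σ + 3 ^ n))                          ≡⟨ cong (λ p → suc ((σ + p) + (σ + p))) (1+2*sum-powersOf3 n) ⟨
  suc ((σ + suc (σ + σ)) + (σ + suc (σ + σ)))              ≡⟨ tripled σ ⟩
  3 * suc (σ + σ)                                          ≡⟨ cong (3 *_) (1+2*sum-powersOf3 n) ⟩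
  3 ^ suc n                                                ∎
  where
  open ≡-Reasoning
  σ = sum (powersOf3 n)
  tripled : ∀ σ → suc ((σ + suc (σ + σ)) + (σ + suc (σ + σ))) ≡ 3 * suc (σ + σ)
  tripled = solve-∀ℕ

sum-powersOf3<3^ : ∀ n → sum (powersOf3 n) < 3 ^ n
sum-powersOf3<3^ n = ℕₚ.≤-trans (s≤s (ℕₚ.m≤m+n _ _)) (ℕₚ.≤-reflexive (1+2*sum-powersOf3 n))

powersOf3-bounds : ∀ n → All (λ x → 1 ≤ x × x ≤ 3 ^ n) (powersOf3 (suc n))
powersOf3-bounds n =
  Allₚ.map⁺ (All.tabulate λ {i} i∈ → ℕₚ.m^n>0 3 i , ℕₚ.^-monoʳ-≤ 3 (ℕₚ.≤-pred (∈-upTo⁻ i∈)))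

powersOf3-unique : ∀ n → Unique (powersOf3 n)
powersOf3-unique n = subst Unique (sym (Listₚ.map-upTo (3 ^_) n))
  (Uniqueₚ.applyUpTo⁺₁ (3 ^_) n λ i<j _ → ℕₚ.<⇒≢ (ℕₚ.^-monoʳ-< 3 (s≤s (s≤s z≤n)) i<j))

powersOf3-dissociated : ∀ n → Dissociated (powersOf3 n)
powersOf3-dissociated zero    [] [] _ = refl
powersOf3-dissociated (suc n) = subst Dissociated (sym (powersOf3-suc n))
  (dissociated-∷ʳ (powersOf3 n) (3 ^ n) (powersOf3-dissociated n) (sum-powersOf3<3^ n))

powersOf3-spans : ∀ n → SpansUpTo (sum (powersOf3 n)) (powersOf3 n)
powersOf3-spans zero    .zero z≤n = here refl
powersOf3-spans (suc n) = subst₂ SpansUpTo (sym (sum-powersOf3-suc n)) (sym (powersOf3-suc n))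
  (spansUpTo-∷ʳ (powersOf3 n) (ℕₚ.≤-reflexive (sym (1+2*sum-powersOf3 n))) (powersOf3-spans n))

^-cancelʳ-< : ∀ b .{{_ : NonZero b}} {m n} → b ^ m < b ^ n → m < n
^-cancelʳ-< b lt = ℕₚ.≰⇒> λ n≤m → ℕₚ.<⇒≱ lt (ℕₚ.^-monoʳ-≤ b n≤m)

spans⇒k+2≤length : ∀ k L → 3 ^ suc k < 2 * N → Spans[ N ] L → k + 2 ≤ length L
spans⇒k+2≤length {N} k L 3^<2N span = subst (_≤ length L) (ℕₚ.+-comm 2 k) (^-cancelʳ-< 3 (begin-strict
  3 ^ suc k     <⟨ 3^<2N ⟩
  2 * N         ≡⟨ cong (_+_ N) (ℕₚ.+-identityʳ N) ⟩
  N + N         <⟨ ℕₚ.n<1+n (N + N) ⟩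
  suc (N + N)   ≤⟨ spans⇒length L span ⟩
  3 ^ length L  ∎))
  where open ℕₚ.≤-Reasoning

2*tOf : ∀ k → 2 * tOf k ≡ suc (3 ^ suc k)
2*tOf k = trans (doubled (sum (powersOf3 (suc k)))) (cong suc (1+2*sum-powersOf3 (suc k)))
  where
  doubled : ∀ σ → 2 * suc σ ≡ suc (suc (σ + σ))
  doubled = solve-∀ℕ

tOf≤⇔ : ∀ k N → tOf k ≤ N ⇔ 3 ^ suc k < 2 * N
tOf≤⇔ k N = mk⇔ (λ t≤N → subst (_≤ 2 * N) (2*tOf k) (ℕₚ.*-monoʳ-≤ 2 t≤N))
                (λ 3^<2N → ℕₚ.*-cancelˡ-≤ 2 (subst (_≤ 2 * N) (sym (2*tOf k)) 3^<2N))

length-S₂ : ∀ k → length (S₂ k) ≡ k + 2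
length-S₂ k = begin
  length (powersOf3 (suc k) ++ tOf k ∷ [])  ≡⟨ Listₚ.length-++ (powersOf3 (suc k)) ⟩
  length (powersOf3 (suc k)) + 1            ≡⟨ cong (_+ 1) (Listₚ.length-map (3 ^_) (upTo (suc k))) ⟩
  length (upTo (suc k)) + 1                 ≡⟨ cong (_+ 1) (Listₚ.length-upTo (suc k)) ⟩
  suc k + 1                                 ≡⟨ ℕₚ.+-suc k 1 ⟨
  k + 2                                     ∎
  where open ≡-Reasoning

S₂-subset : ∀ k → 3 ^ k ≤ N → tOf k ≤ N → IsSubsetOf[ N ] (S₂ k)
S₂-subset k 3^k≤N t≤N =
  unique-∷ʳ (powersOf3-unique (suc k)) (All.tabulate (s≤s ∘ ∈⇒≤sum)) ,
  Allₚ.++⁺ (All.map (Product.map₂ (λ x≤3^k → ℕₚ.≤-trans x≤3^k 3^k≤N)) (powersOf3-bounds k)) ((s≤s z≤n , t≤N) ∷ [])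

S₂-dissociated : ∀ k → Dissociated (S₂ k)
S₂-dissociated k = dissociated-∷ʳ (powersOf3 (suc k)) (tOf k) (powersOf3-dissociated (suc k)) ℕₚ.≤-refl

S₂-spans : ∀ k → SpansUpTo (3 ^ suc k) (S₂ k)
S₂-spans k = subst (λ m → SpansUpTo m (S₂ k)) σ+t≡3^
  (spansUpTo-∷ʳ (powersOf3 (suc k)) (s≤s (ℕₚ.m≤m+n σ σ)) (powersOf3-spans (suc k)))
  where
  σ = sum (powersOf3 (suc k))
  σ+t≡3^ : σ + tOf k ≡ 3 ^ suc k
  σ+t≡3^ = trans (ℕₚ.+-suc σ σ) (1+2*sum-powersOf3 (suc k))

-- The hypothesis 1 ≤ N is implied by 3 ^ k ≤ N.
proposition3p4 : ∀ (N k : ℕ) → 1 ≤ N → 3 ^ k ≤ N → N < 3 ^ suc k →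
    ((3 ^ suc k < 2 * N) ⇔ (IsSubsetOf[ N ] (S₂ k) × MinSpanning[ N ] (S₂ k) × MaximalDissociatedIn[ N ] (S₂ k)))
    × (3 ^ suc k < 2 * N → DsIs N (k + 2) × DdMinusIs N (k + 2))
proposition3p4 N k _ 3^k≤N N<3^k+1 =
  mk⇔ (λ h → subset h , minimum h , maximal h) (λ (S₂⊆[N] , _) → Equivalence.to (tOf≤⇔ k N) (t≤N S₂⊆[N])) ,
  λ h → (S₂ k , minimum h , length-S₂ k) ,
        (S₂ k , (maximal h , length-S₂ k) , λ D D-max → spans⇒k+2≤length k D h (maximalDissociated⇒spans D-max))
  where
  spans : Spans[ N ] (S₂ k)
  spans x _ x≤N = S₂-spans k x (ℕₚ.≤-trans x≤N (ℕₚ.<⇒≤ N<3^k+1))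

  subset : 3 ^ suc k < 2 * N → IsSubsetOf[ N ] (S₂ k)
  subset h = S₂-subset k 3^k≤N (Equivalence.from (tOf≤⇔ k N) h)

  minimum : 3 ^ suc k < 2 * N → MinSpanning[ N ] (S₂ k)
  minimum h = subset h , spans , λ L _ L-spans →
    subst (_≤ length L) (sym (length-S₂ k)) (spans⇒k+2≤length k L h L-spans)

  maximal : 3 ^ suc k < 2 * N → MaximalDissociatedIn[ N ] (S₂ k)
  maximal h = dissociated∧spans⇒maximal (subset h) (S₂-dissociated k) spans

  t≤N : IsSubsetOf[ N ] (S₂ k) → tOf k ≤ N
  t≤N (_ , bounds) = proj₂ (All.head (Allₚ.++⁻ʳ (powersOf3 (suc k)) bounds))
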